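{- Let $f(x)=ax^2+bx+c$ be an irreducible quadratic polynomial in $\mathbb{Z}[x]$ with $a>0$ such that $f(x)$ is positive and increasing for real $x\ge1$, and let $D=b^2-4ac$. There is a constant $K$ depending only on $f$ such that for all $n\ge1$ and $Q\ge1$, the number of primes $p$ with $p\nmid D$, $Q\le p<2Q$, such that $p^2\mid f(i)$ for some integer $1\le i\le n$, is at most $K n^2/Q^2$.
   Formalization: The parameter Q ranges over the rationals, and positivity and monotonicity of f are assumed for rational x ≥ 1 in place of real x ≥ 1. -}

module Defs where

open import Data.Nat as ℕ using (ℕ)
open import Data.Integer as ℤ using (ℤ; +_; -_)
open import Data.Rational as ℚ using (ℚ)
open import Data.Product using (Σ; ∃; _×_; _,_)
open import Data.Sum using (_⊎_)
open import Relation.Binary.PropositionalEquality using (_≡_)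
open import Relation.Nullary using (¬_)

ℤ→ℚ : ℤ → ℚ
ℤ→ℚ z = z ℚ./ 1

ℕ→ℚ : ℕ → ℚ
ℕ→ℚ n = ℤ→ℚ (+ n)

evalℤ : ℤ → ℤ → ℤ → ℤ → ℤ
evalℤ a b c x = a ℤ.* x ℤ.* x ℤ.+ b ℤ.* x ℤ.+ c

evalℚ : ℤ → ℤ → ℤ → ℚ → ℚ
evalℚ a b c x = ℤ→ℚ a ℚ.* x ℚ.* x ℚ.+ ℤ→ℚ b ℚ.* x ℚ.+ ℤ→ℚ c

disc : ℤ → ℤ → ℤ → ℤ
disc a b c = b ℤ.* b ℤ.- + 4 ℤ.* a ℤ.* c

IsUnitℤ : ℤ → Set
IsUnitℤ d = d ≡ + 1 ⊎ d ≡ - (+ 1)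

-- Irreducibility in ℤ[x] of the quadratic a x^2 + b x + c (a ≠ 0).
-- f is a nonzero nonunit (automatic since deg f = 2), and in any
-- factorization f = g h in ℤ[x] one factor is a unit.  Since degrees add,
-- a factorization has degrees (0,2) or (1,1); these are the two clauses:
--  * f = d · (a' x^2 + b' x + c')  forces d = ±1;
--  * f = (p x + q)(r x + s)  is impossible (p, r ≠ 0 automatically as a ≠ 0,
--    and a degree-1 factor is never a unit).
IrreducibleQuadℤ : ℤ → ℤ → ℤ → Set
IrreducibleQuadℤ a b c =
  (∀ d a' b' c' → a ≡ d ℤ.* a' → b ≡ d ℤ.* b' → c ≡ d ℤ.* c' → IsUnitℤ d)
  × (∀ p q r s → ¬ (a ≡ p ℤ.* r × b ≡ p ℤ.* s ℤ.+ q ℤ.* r × c ≡ q ℤ.* s))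

{-# OPTIONS --safe #-}
-- For p² ∣ f(i) write f(i) = k p² and X = |2ai + b|: completing the square gives
-- X² = D + N p² with N = 4ak, and N p² = 4a f(i) = O(n²).  Let p₀ be the least prime in
-- the list, so that all of them lie in [p₀, 2p₀).  If p₀² < |D| there are fewer than 2p₀
-- of them, which is enough.  Otherwise X ≥ p, and for two primes r, p of the same level N
-- the integer u = X_r p − X_p r satisfies u (X_r p + X_p r) = D (p² − r²), so |u| ≤ |D|;
-- and u determines p, because X_r (p − q) = r (X_p − X_q) with r ∤ X_r (as r ∤ D) and
-- |p − q| < r.  Hence each of the O(n²/p₀²) levels contains at most 2|D| + 1 primes.
module Submission where

open import Defs
open import Data.Nat as ℕ using (ℕ)
open import Data.Nat.Primality using (Prime)
open import Data.Integer as ℤ using (ℤ; +_)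
open import Data.Integer.Divisibility as ℤᵈ using ()
open import Data.Rational as ℚ using (ℚ)
open import Data.Product using (Σ; ∃; _×_; _,_)
open import Data.List using (List; length)
open import Data.List.Relation.Unary.All using (All)
open import Data.List.Relation.Unary.Unique.Propositional using (Unique)
open import Relation.Nullary using (¬_)

open import Data.Nat using (zero; suc; _≤_; _<_; z≤n; s≤s)
import Data.Nat.Properties as ℕP
import Data.Nat.Coprimality as Coprimality
open import Data.Nat.Divisibility as ℕᵈ using (_∣_)
open import Data.Nat.DivMod using (_/_; m*n/n≡m; /-monoˡ-≤; m/n*n≤m)
open import Data.Nat.Primality using (euclidsLemma; prime⇒nonZero)
import Data.Nat.Tactic.RingSolver as ℕRing
open import Data.Integer using (-[1+_])
import Data.Integer.Properties as ℤP
open import Algebra.Properties.AbelianGroup ℤP.+-0-abelianGroup using (∙-cancelʳ)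
import Data.Integer.Divisibility.Signed as ℤˢ
open import Data.Integer.Tactic.RingSolver using (solve-∀)
open import Data.Rational using (mkℚ; *≤*)
import Data.Rational.Properties as ℚP
open import Data.List using ([]; _∷_; map; filter)
import Data.List.Properties as ListP
open import Data.List.Extrema.Nat using (min; min≤⊤; min≤xs; argmin-all)
open import Data.List.Relation.Unary.All as All using ([]; _∷_)
import Data.List.Relation.Unary.All.Properties as AllP
open import Data.List.Relation.Unary.AllPairs using (AllPairs; []; _∷_)
import Data.List.Relation.Unary.AllPairs.Properties as AllPairsP
open import Data.Product using (proj₁; proj₂)
open import Data.Sum using (inj₁; inj₂)
open import Function using (id; _∘_; _∘′_; _on_)
open import Level using (0ℓ)
open import Relation.Binary.Core using (Rel)
open import Relation.Binary.PropositionalEquality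
open import Relation.Nullary using (yes; no; contradiction)
open import Relation.Unary using (Pred; Decidable)
open import Relation.Unary.Properties using (∁?)

length-filter-split : ∀ {A : Set} {P : Pred A 0ℓ} (P? : Decidable P) xs →
  length xs ≡ length (filter P? xs) ℕ.+ length (filter (∁? P?) xs)
length-filter-split P? [] = refl
length-filter-split P? (x ∷ xs) with P? x
... | yes _ = cong suc (length-filter-split P? xs)
... | no _ = trans (cong suc (length-filter-split P? xs)) (sym (ℕP.+-suc _ _))

allPairs-mapWith : ∀ {A : Set} {P : Pred A 0ℓ} {R S : Rel A 0ℓ} →
  (∀ {x y} → P x → P y → R x y → S x y) →
  ∀ {xs} → All P xs → AllPairs R xs → AllPairs S xs
allPairs-mapWith f [] [] = []
allPairs-mapWith f (px ∷ pxs) (rxs ∷ rs) =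
  All.zipWith (λ (py , rxy) → f px py rxy) (pxs , rxs) ∷ allPairs-mapWith f pxs rs

module _ {A : Set} {R : Rel A 0ℓ} (κ : A → ℕ) (W : ℕ)
         (fibre≤ : ∀ k {ys} → All (λ y → κ y ≡ k) ys → AllPairs R ys → length ys ≤ W) where

  fibres≤⇒length≤ : ∀ M {xs} → All (λ x → κ x < M) xs → AllPairs R xs → length xs ≤ M ℕ.* W
  fibres≤⇒length≤ zero {[]} _ _ = z≤n
  fibres≤⇒length≤ zero {_ ∷ _} (() ∷ _) _
  fibres≤⇒length≤ (suc M) {xs} κ<1+M distinct = begin
    length xs                                          ≡⟨ length-filter-split top? xs ⟩
    length (filter top? xs) ℕ.+ length (filter (∁? top?) xs)
      ≤⟨ ℕP.+-mono-≤ (fibre≤ M (AllP.all-filter top? xs) (AllPairsP.filter⁺ top? distinct))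
                     (fibres≤⇒length≤ M below (AllPairsP.filter⁺ (∁? top?) distinct)) ⟩
    W ℕ.+ M ℕ.* W                                      ∎
    where
    open ℕP.≤-Reasoning
    top? : Decidable (λ x → κ x ≡ M)
    top? x = κ x ℕP.≟ M
    below : All (λ x → κ x < M) (filter (∁? top?) xs)
    below = All.zipWith (λ (κ<1+M , κ≢M) → ℕP.≤∧≢⇒< (ℕP.≤-pred κ<1+M) κ≢M)
              (AllP.filter⁺ (∁? top?) κ<1+M , AllP.all-filter (∁? top?) xs)

constant-unique⇒length≤1 : ∀ {k} {xs : List ℕ} → All (_≡ k) xs → Unique xs → length xs ≤ 1
constant-unique⇒length≤1 [] _ = z≤n
constant-unique⇒length≤1 (_ ∷ []) _ = s≤s z≤n
constant-unique⇒length≤1 (x≡k ∷ y≡k ∷ _) ((x≢y ∷ _) ∷ _) = contradiction (trans x≡k (sym y≡k)) x≢y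

unique-bounded⇒length≤ : ∀ n {xs : List ℕ} → All (_< n) xs → Unique xs → length xs ≤ n
unique-bounded⇒length≤ n xs<n unique =
  subst (_ ≤_) (ℕP.*-identityʳ n) (fibres≤⇒length≤ id 1 (λ _ → constant-unique⇒length≤1) n xs<n unique)

module _ {A : Set} (name κ : A → ℕ) (code : A → A → ℕ) (W : ℕ)
         (code< : ∀ r e → κ e ≡ κ r → code r e < W)
         (code-injective : ∀ r e e′ → κ e ≡ κ r → κ e′ ≡ κ r → code r e ≡ code r e′ → name e ≡ name e′)
         where

  codedFibre⇒length≤ : ∀ k {ys} → All (λ y → κ y ≡ k) ys → AllPairs (_≢_ on name) ys → length ys ≤ W
  codedFibre⇒length≤ k {[]} _ _ = z≤n
  codedFibre⇒length≤ k {r ∷ ys} κ≡k distinct =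
    subst (_≤ W) (ListP.length-map (code r) (r ∷ ys))
      (unique-bounded⇒length≤ W (AllP.map⁺ (All.map (code< r _) κ≡κr))
        (AllPairsP.map⁺ (allPairs-mapWith (λ e≡r e′≡r e≢e′ → e≢e′ ∘ code-injective r _ _ e≡r e′≡r) κ≡κr distinct)))
    where
    κ≡κr : All (λ e → κ e ≡ κ r) (r ∷ ys)
    κ≡κr = All.map (λ e≡k → trans e≡k (sym (All.head κ≡k))) κ≡k

  coded⇒length≤ : ∀ M {xs} → All (λ x → κ x < M) xs → AllPairs (_≢_ on name) xs → length xs ≤ M ℕ.* W
  coded⇒length≤ = fibres≤⇒length≤ κ W codedFibre⇒length≤

map-proj₁-toList : ∀ {A : Set} {P : A → Set} {xs} (pxs : All P xs) → map proj₁ (All.toList pxs) ≡ xs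
map-proj₁-toList [] = refl
map-proj₁-toList (_ ∷ pxs) = cong (_ ∷_) (map-proj₁-toList pxs)

∣i∣≤n⇒0≤i+n : ∀ i {n} → ℤ.∣ i ∣ ≤ n → ℤ.0ℤ ℤ.≤ i ℤ.+ + n
∣i∣≤n⇒0≤i+n (+ m) {n} _ = subst (ℤ.0ℤ ℤ.≤_) (ℤP.pos-+ m n) (ℤ.+≤+ z≤n)
∣i∣≤n⇒0≤i+n -[1+ m ] ∣i∣≤n = subst (ℤ.0ℤ ℤ.≤_) (sym (ℤP.⊖-≥ ∣i∣≤n)) (ℤ.+≤+ z≤n)

∣i+n∣≤n+n : ∀ i {n} → ℤ.∣ i ∣ ≤ n → ℤ.∣ i ℤ.+ + n ∣ ≤ n ℕ.+ n
∣i+n∣≤n+n i {n} ∣i∣≤n = ℕP.≤-trans (ℤP.∣i+j∣≤∣i∣+∣j∣ i (+ n)) (ℕP.+-monoˡ-≤ n ∣i∣≤n)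

∣i+n∣-injective : ∀ {i j n} → ℤ.∣ i ∣ ≤ n → ℤ.∣ j ∣ ≤ n → ℤ.∣ i ℤ.+ + n ∣ ≡ ℤ.∣ j ℤ.+ + n ∣ → i ≡ j
∣i+n∣-injective {i} {j} {n} ∣i∣≤n ∣j∣≤n eq = ∙-cancelʳ (+ n) i j (begin
  i ℤ.+ + n            ≡⟨ ℤP.0≤i⇒+∣i∣≡i (∣i∣≤n⇒0≤i+n i ∣i∣≤n) ⟨
  + ℤ.∣ i ℤ.+ + n ∣    ≡⟨ cong +_ eq ⟩
  + ℤ.∣ j ℤ.+ + n ∣    ≡⟨ ℤP.0≤i⇒+∣i∣≡i (∣i∣≤n⇒0≤i+n j ∣j∣≤n) ⟩
  j ℤ.+ + n            ∎)
  where open ≡-Reasoning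

∣∧<⇒≡0 : ∀ {m n} → m ∣ n → n < m → n ≡ 0
∣∧<⇒≡0 {n = zero} _ _ = refl
∣∧<⇒≡0 {n = suc _} m∣n n<m = contradiction m∣n (ℕᵈ.>⇒∤ n<m)

m*o≡n*p∧p≤o⇒m≤n : ∀ {m n o p} .{{_ : ℕ.NonZero o}} → m ℕ.* o ≡ n ℕ.* p → p ≤ o → m ≤ n
m*o≡n*p∧p≤o⇒m≤n {m} {n} {o} {p} mo≡np p≤o =
  ℕP.*-cancelʳ-≤ m n o (subst (_≤ n ℕ.* o) (sym mo≡np) (ℕP.*-monoʳ-≤ n p≤o))

m*n≤o⇒m≤o/n : ∀ {m n o} .{{_ : ℕ.NonZero n}} → m ℕ.* n ≤ o → m ≤ o / n
m*n≤o⇒m≤o/n {m} {n} {o} m*n≤o = subst (_≤ o / n) (m*n/n≡m m n) (/-monoˡ-≤ n m*n≤o)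

m≡j+n⇒n≤m+∣j∣ : ∀ {m j n} → + m ≡ j ℤ.+ + n → n ≤ m ℕ.+ ℤ.∣ j ∣
m≡j+n⇒n≤m+∣j∣ {m} {j} {n} m≡j+n =
  subst (_≤ m ℕ.+ ℤ.∣ j ∣) (cong ℤ.∣_∣ m-j≡n) (ℤP.∣i-j∣≤∣i∣+∣j∣ (+ m) j)
  where
  j+n-j≡n : ∀ j n → j ℤ.+ n ℤ.- j ≡ n
  j+n-j≡n = solve-∀
  m-j≡n : + m ℤ.- j ≡ + n
  m-j≡n = trans (cong (ℤ._- j) m≡j+n) (j+n-j≡n j (+ n))

+∣i∣*+∣i∣≡i*i : ∀ i → + ℤ.∣ i ∣ ℤ.* + ℤ.∣ i ∣ ≡ i ℤ.* i
+∣i∣*+∣i∣≡i*i i with ℤP.+∣i∣≡i⊎+∣i∣≡-i i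
... | inj₁ eq = cong₂ ℤ._*_ eq eq
... | inj₂ eq = trans (cong₂ ℤ._*_ eq eq) (neg*neg i)
  where
  neg*neg : ∀ i → ℤ.- i ℤ.* ℤ.- i ≡ i ℤ.* i
  neg*neg = solve-∀

∣p-q∣<p₀ : ∀ {p₀ p q} → p₀ ≤ p → p < p₀ ℕ.+ p₀ → p₀ ≤ q → q < p₀ ℕ.+ p₀ → ℤ.∣ + p ℤ.- + q ∣ < p₀
∣p-q∣<p₀ {zero} _ () _ _
∣p-q∣<p₀ {p₀@(suc _)} {p} {q} p₀≤p p<2p₀ p₀≤q q<2p₀ rewrite ℤP.m-n≡m⊖n p q with ℕP.≤-total p q
... | inj₁ p≤q rewrite ℤP.∣⊖∣-≤ p≤q = ℕP.m<n+o⇒m∸n<o q p (ℕP.<-≤-trans q<2p₀ (ℕP.+-monoˡ-≤ p₀ p₀≤p))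
... | inj₂ q≤p rewrite ℤP.∣m⊖n∣≡∣n⊖m∣ p q | ℤP.∣⊖∣-≤ q≤p = ℕP.m<n+o⇒m∸n<o p q (ℕP.<-≤-trans p<2p₀ (ℕP.+-monoˡ-≤ p₀ p₀≤q))

∣root⇒∣D : ∀ {D X N r} → + X ℤ.* + X ≡ D ℤ.+ + N ℤ.* (+ r ℤ.* + r) → r ∣ X → r ∣ ℤ.∣ D ∣
∣root⇒∣D {D} {X} {N} {r} X²≡D+Nr² r∣X = ℤˢ.∣⇒∣ᵤ {i = D} (ℤˢ.∣m+n∣n⇒∣m r∣D+Nr² r∣Nr²)
  where
  r∣D+Nr² : + r ℤˢ.∣ D ℤ.+ + N ℤ.* (+ r ℤ.* + r)
  r∣D+Nr² = subst (+ r ℤˢ.∣_) X²≡D+Nr² (ℤˢ.∣m⇒∣m*n (+ X) (ℤˢ.∣ᵤ⇒∣ {i = + X} r∣X))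
  r∣Nr² : + r ℤˢ.∣ + N ℤ.* (+ r ℤ.* + r)
  r∣Nr² = ℤˢ.∣n⇒∣m*n (+ N) (ℤˢ.∣m⇒∣m*n (+ r) ℤˢ.∣-refl)

root≥p : ∀ {D X N p} → + X ℤ.* + X ≡ D ℤ.+ + N ℤ.* (+ p ℤ.* + p) → 2 ≤ N → ℤ.∣ D ∣ ≤ p ℕ.* p → p ≤ X
root≥p {D} {X} {N} {p} X²≡ 2≤N ∣D∣≤p² =
  ℕP.≮⇒≥ (λ X<p → ℕP.<⇒≱ (ℕP.*-mono-< X<p X<p) (ℕP.+-cancelʳ-≤ (p ℕ.* p) (p ℕ.* p) (X ℕ.* X) (begin
    p ℕ.* p ℕ.+ p ℕ.* p            ≡⟨ cong (p ℕ.* p ℕ.+_) (ℕP.+-identityʳ (p ℕ.* p)) ⟨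
    2 ℕ.* (p ℕ.* p)                ≤⟨ ℕP.*-monoˡ-≤ (p ℕ.* p) 2≤N ⟩
    N ℕ.* (p ℕ.* p)                ≤⟨ m≡j+n⇒n≤m+∣j∣ {j = D} X²≡D+Np² ⟩
    X ℕ.* X ℕ.+ ℤ.∣ D ∣            ≤⟨ ℕP.+-monoʳ-≤ (X ℕ.* X) ∣D∣≤p² ⟩
    X ℕ.* X ℕ.+ p ℕ.* p            ∎)))
  where
  open ℕP.≤-Reasoning
  X²≡D+Np² : + (X ℕ.* X) ≡ D ℤ.+ + (N ℕ.* (p ℕ.* p))
  X²≡D+Np² = trans (ℤP.pos-* X X) (trans X²≡ (cong (λ t → D ℤ.+ t) (trans (cong (+ N ℤ.*_) (sym (ℤP.pos-* p p))) (sym (ℤP.pos-* N (p ℕ.* p))))))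

X[p-q]≡r[Y-Z] : ∀ (X p Y r q Z : ℤ) →
  X ℤ.* p ℤ.- Y ℤ.* r ≡ X ℤ.* q ℤ.- Z ℤ.* r → X ℤ.* (p ℤ.- q) ≡ r ℤ.* (Y ℤ.- Z)
X[p-q]≡r[Y-Z] X p Y r q Z eq = begin
  X ℤ.* (p ℤ.- q)                                                       ≡⟨ expand X p Y r q Z ⟩
  (X ℤ.* p ℤ.- Y ℤ.* r) ℤ.- (X ℤ.* q ℤ.- Z ℤ.* r) ℤ.+ r ℤ.* (Y ℤ.- Z)   ≡⟨ cong (λ t → t ℤ.- (X ℤ.* q ℤ.- Z ℤ.* r) ℤ.+ r ℤ.* (Y ℤ.- Z)) eq ⟩
  (X ℤ.* q ℤ.- Z ℤ.* r) ℤ.- (X ℤ.* q ℤ.- Z ℤ.* r) ℤ.+ r ℤ.* (Y ℤ.- Z)   ≡⟨ cancel (X ℤ.* q ℤ.- Z ℤ.* r) (r ℤ.* (Y ℤ.- Z)) ⟩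
  r ℤ.* (Y ℤ.- Z)                                                       ∎
  where
  open ≡-Reasoning
  expand : ∀ (X p Y r q Z : ℤ) → X ℤ.* (p ℤ.- q) ≡ (X ℤ.* p ℤ.- Y ℤ.* r) ℤ.- (X ℤ.* q ℤ.- Z ℤ.* r) ℤ.+ r ℤ.* (Y ℤ.- Z)
  expand = solve-∀
  cancel : ∀ (t w : ℤ) → t ℤ.- t ℤ.+ w ≡ w
  cancel = solve-∀

Xp-Yr≡Xq-Zr⇒p≡q : ∀ {X Y Z r p q} → Prime r → ¬ r ∣ X → ℤ.∣ + p ℤ.- + q ∣ < r →
  + X ℤ.* + p ℤ.- + Y ℤ.* + r ≡ + X ℤ.* + q ℤ.- + Z ℤ.* + r → p ≡ q
Xp-Yr≡Xq-Zr⇒p≡q {X} {Y} {Z} {r} {p} {q} r-prime r∤X ∣p-q∣<r eq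
  with euclidsLemma X ℤ.∣ + p ℤ.- + q ∣ r-prime r∣X∣p-q∣
  where
  r∣X∣p-q∣ : r ∣ X ℕ.* ℤ.∣ + p ℤ.- + q ∣
  r∣X∣p-q∣ = subst (r ∣_)
    (trans (sym (ℤP.abs-* (+ r) (+ Y ℤ.- + Z)))
      (trans (cong ℤ.∣_∣ (sym (X[p-q]≡r[Y-Z] (+ X) (+ p) (+ Y) (+ r) (+ q) (+ Z) eq))) (ℤP.abs-* (+ X) (+ p ℤ.- + q))))
    (ℕᵈ.m∣m*n ℤ.∣ + Y ℤ.- + Z ∣)
... | inj₁ r∣X = contradiction r∣X r∤X
... | inj₂ r∣∣p-q∣ = ℤP.+-injective (ℤP.i-j≡0⇒i≡j (+ p) (+ q) (ℤP.∣i∣≡0⇒i≡0 (∣∧<⇒≡0 r∣∣p-q∣ ∣p-q∣<r)))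

p²≤Xp+Yr : ∀ {X Y r p} → p ≤ r ℕ.+ r → r ≤ X → p ≤ Y → p ℕ.* p ≤ X ℕ.* p ℕ.+ Y ℕ.* r
p²≤Xp+Yr {X} {Y} {r} {p} p≤2r r≤X p≤Y = begin
  p ℕ.* p                ≤⟨ ℕP.*-monoʳ-≤ p p≤2r ⟩
  p ℕ.* (r ℕ.+ r)        ≡⟨ ℕP.*-distribˡ-+ p r r ⟩
  p ℕ.* r ℕ.+ p ℕ.* r    ≤⟨ ℕP.+-mono-≤ (ℕP.≤-trans (ℕP.*-monoʳ-≤ p r≤X) (ℕP.≤-reflexive (ℕP.*-comm p X)))
                                         (ℕP.*-monoˡ-≤ r p≤Y) ⟩
  X ℕ.* p ℕ.+ Y ℕ.* r    ∎
  where open ℕP.≤-Reasoning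

[Xp-Yr][Xp+Yr]≡D[p²-r²] : ∀ {D N X Y r p : ℤ} →
  X ℤ.* X ≡ D ℤ.+ N ℤ.* (r ℤ.* r) → Y ℤ.* Y ≡ D ℤ.+ N ℤ.* (p ℤ.* p) →
  (X ℤ.* p ℤ.- Y ℤ.* r) ℤ.* (X ℤ.* p ℤ.+ Y ℤ.* r) ≡ D ℤ.* (p ℤ.* p ℤ.- r ℤ.* r)
[Xp-Yr][Xp+Yr]≡D[p²-r²] {D} {N} {X} {Y} {r} {p} X²≡ Y²≡ = begin
  (X ℤ.* p ℤ.- Y ℤ.* r) ℤ.* (X ℤ.* p ℤ.+ Y ℤ.* r)   ≡⟨ differenceOfSquares X Y r p ⟩
  (X ℤ.* X) ℤ.* (p ℤ.* p) ℤ.- (Y ℤ.* Y) ℤ.* (r ℤ.* r) ≡⟨ cong₂ (λ s t → s ℤ.* (p ℤ.* p) ℤ.- t ℤ.* (r ℤ.* r)) X²≡ Y²≡ ⟩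
  (D ℤ.+ N ℤ.* (r ℤ.* r)) ℤ.* (p ℤ.* p) ℤ.- (D ℤ.+ N ℤ.* (p ℤ.* p)) ℤ.* (r ℤ.* r) ≡⟨ levelCancels D N r p ⟩
  D ℤ.* (p ℤ.* p ℤ.- r ℤ.* r)                        ∎
  where
  open ≡-Reasoning
  differenceOfSquares : ∀ X Y r p → (X ℤ.* p ℤ.- Y ℤ.* r) ℤ.* (X ℤ.* p ℤ.+ Y ℤ.* r) ≡ (X ℤ.* X) ℤ.* (p ℤ.* p) ℤ.- (Y ℤ.* Y) ℤ.* (r ℤ.* r)
  differenceOfSquares = solve-∀
  levelCancels : ∀ D N r p → (D ℤ.+ N ℤ.* (r ℤ.* r)) ℤ.* (p ℤ.* p) ℤ.- (D ℤ.+ N ℤ.* (p ℤ.* p)) ℤ.* (r ℤ.* r) ≡ D ℤ.* (p ℤ.* p ℤ.- r ℤ.* r)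
  levelCancels = solve-∀

∣Xp-Yr∣≤∣D∣ : ∀ {D N X Y r p} →
  + X ℤ.* + X ≡ D ℤ.+ + N ℤ.* (+ r ℤ.* + r) → + Y ℤ.* + Y ≡ D ℤ.+ + N ℤ.* (+ p ℤ.* + p) →
  0 < p → p ≤ r ℕ.+ r → r ≤ p ℕ.+ p → r ≤ X → p ≤ Y →
  ℤ.∣ + X ℤ.* + p ℤ.- + Y ℤ.* + r ∣ ≤ ℤ.∣ D ∣
∣Xp-Yr∣≤∣D∣ {D} {N} {X} {Y} {r} {p} X²≡ Y²≡ 0<p p≤2r r≤2p r≤X p≤Y =
  m*o≡n*p∧p≤o⇒m≤n {{ℕ.>-nonZero (ℕP.<-≤-trans (ℕP.*-mono-< 0<p 0<p) p²≤S)}} ∣u∣*S≡∣D∣*∣δ∣ ∣δ∣≤S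
  where
  S = X ℕ.* p ℕ.+ Y ℕ.* r
  u = + X ℤ.* + p ℤ.- + Y ℤ.* + r
  δ = + p ℤ.* + p ℤ.- + r ℤ.* + r
  p²≤S : p ℕ.* p ≤ S
  p²≤S = p²≤Xp+Yr p≤2r r≤X p≤Y
  r²≤S : r ℕ.* r ≤ S
  r²≤S = ℕP.≤-trans (p²≤Xp+Yr r≤2p p≤Y r≤X) (ℕP.≤-reflexive (ℕP.+-comm (Y ℕ.* r) (X ℕ.* p)))
  +S≡ : + S ≡ + X ℤ.* + p ℤ.+ + Y ℤ.* + r
  +S≡ = trans (ℤP.pos-+ (X ℕ.* p) (Y ℕ.* r)) (cong₂ ℤ._+_ (ℤP.pos-* X p) (ℤP.pos-* Y r))
  ∣u∣*S≡∣D∣*∣δ∣ : ℤ.∣ u ∣ ℕ.* S ≡ ℤ.∣ D ∣ ℕ.* ℤ.∣ δ ∣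
  ∣u∣*S≡∣D∣*∣δ∣ = begin
    ℤ.∣ u ∣ ℕ.* ℤ.∣ + S ∣   ≡⟨ ℤP.abs-* u (+ S) ⟨
    ℤ.∣ u ℤ.* + S ∣        ≡⟨ cong (λ s → ℤ.∣ u ℤ.* s ∣) +S≡ ⟩
    ℤ.∣ u ℤ.* (+ X ℤ.* + p ℤ.+ + Y ℤ.* + r) ∣ ≡⟨ cong ℤ.∣_∣ ([Xp-Yr][Xp+Yr]≡D[p²-r²] {D} {+ N} {+ X} {+ Y} {+ r} {+ p} X²≡ Y²≡) ⟩
    ℤ.∣ D ℤ.* δ ∣          ≡⟨ ℤP.abs-* D δ ⟩
    ℤ.∣ D ∣ ℕ.* ℤ.∣ δ ∣    ∎
    where open ≡-Reasoning
  ∣δ∣≤S : ℤ.∣ δ ∣ ≤ S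
  ∣δ∣≤S = begin
    ℤ.∣ δ ∣                               ≡⟨ cong ℤ.∣_∣ (trans (sym (cong₂ ℤ._-_ (ℤP.pos-* p p) (ℤP.pos-* r r))) (ℤP.m-n≡m⊖n (p ℕ.* p) (r ℕ.* r))) ⟩
    ℤ.∣ (p ℕ.* p) ℤ.⊖ (r ℕ.* r) ∣          ≤⟨ ℤP.∣m⊝n∣≤m⊔n (p ℕ.* p) (r ℕ.* r) ⟩
    p ℕ.* p ℕ.⊔ r ℕ.* r                    ≤⟨ ℕP.⊔-lub p²≤S r²≤S ⟩
    S                                      ∎
    where open ℕP.≤-Reasoning

record WindowRoot (D : ℤ) (p₀ M p : ℕ) : Set where
  field
    isPrime : Prime p
    p∤D : ¬ p ∣ ℤ.∣ D ∣
    p₀≤p : p₀ ≤ p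
    p<2p₀ : p < p₀ ℕ.+ p₀
    root level : ℕ
    root² : + root ℤ.* + root ≡ D ℤ.+ + level ℤ.* (+ p ℤ.* + p)
    p≤root : p ≤ root
    level<M : level < M

open WindowRoot

module _ {D : ℤ} {p₀ M : ℕ} where

  cross : ∀ {r p} → WindowRoot D p₀ M r → WindowRoot D p₀ M p → ℤ
  cross {r} {p} ρ π = + root ρ ℤ.* + p ℤ.- + root π ℤ.* + r

  p≤q+q : ∀ {p q} → WindowRoot D p₀ M p → WindowRoot D p₀ M q → p ≤ q ℕ.+ q
  p≤q+q π ρ = ℕP.<⇒≤ (ℕP.<-≤-trans (p<2p₀ π) (ℕP.+-mono-≤ (p₀≤p ρ) (p₀≤p ρ)))

  ∣cross∣≤∣D∣ : ∀ {r p} (ρ : WindowRoot D p₀ M r) (π : WindowRoot D p₀ M p) →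
    level π ≡ level ρ → ℤ.∣ cross ρ π ∣ ≤ ℤ.∣ D ∣
  ∣cross∣≤∣D∣ {r} {p} ρ π sameLevel =
    ∣Xp-Yr∣≤∣D∣ {D} {level ρ} {root ρ} {root π} (root² ρ) π-root²
      (ℕ.>-nonZero⁻¹ p {{prime⇒nonZero (isPrime π)}}) (p≤q+q π ρ) (p≤q+q ρ π) (p≤root ρ) (p≤root π)
    where
    π-root² : + root π ℤ.* + root π ≡ D ℤ.+ + level ρ ℤ.* (+ p ℤ.* + p)
    π-root² = subst (λ N → + root π ℤ.* + root π ≡ D ℤ.+ + N ℤ.* (+ p ℤ.* + p)) sameLevel (root² π)

  cross-injective : ∀ {r p q} (ρ : WindowRoot D p₀ M r) (π : WindowRoot D p₀ M p) (σ : WindowRoot D p₀ M q) →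
    cross ρ π ≡ cross ρ σ → p ≡ q
  cross-injective ρ π σ = Xp-Yr≡Xq-Zr⇒p≡q {root ρ} {root π} {root σ} (isPrime ρ)
    (p∤D ρ ∘ ∣root⇒∣D {D} {root ρ} {level ρ} (root² ρ))
    (ℕP.<-≤-trans (∣p-q∣<p₀ (p₀≤p π) (p<2p₀ π) (p₀≤p σ) (p<2p₀ σ)) (p₀≤p ρ))

windowRoots-length≤ : ∀ {D p₀ M ps} → Unique ps → All (WindowRoot D p₀ M) ps →
  length ps ≤ M ℕ.* suc (ℤ.∣ D ∣ ℕ.+ ℤ.∣ D ∣)
windowRoots-length≤ {D} {p₀} {M} {ps} unique ρs = begin
  length ps                 ≡⟨ cong length (map-proj₁-toList ρs) ⟨
  length (map proj₁ roots)  ≡⟨ ListP.length-map proj₁ roots ⟩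
  length roots              ≤⟨ coded⇒length≤ proj₁ (level ∘ proj₂) code (suc (∣D∣ ℕ.+ ∣D∣)) code<W code-injective
                                 M (All.universal (level<M ∘ proj₂) roots) distinct ⟩
  M ℕ.* suc (∣D∣ ℕ.+ ∣D∣)   ∎
  where
  open ℕP.≤-Reasoning
  ∣D∣ = ℤ.∣ D ∣
  Root = Σ ℕ (WindowRoot D p₀ M)
  roots : List Root
  roots = All.toList ρs
  code : Root → Root → ℕ
  code (_ , ρ) (_ , π) = ℤ.∣ cross ρ π ℤ.+ + ∣D∣ ∣
  code<W : ∀ (r e : Root) → level (proj₂ e) ≡ level (proj₂ r) → code r e < suc (∣D∣ ℕ.+ ∣D∣)
  code<W (_ , ρ) (_ , π) same = s≤s (∣i+n∣≤n+n (cross ρ π) (∣cross∣≤∣D∣ ρ π same))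
  code-injective : ∀ (r e e′ : Root) → level (proj₂ e) ≡ level (proj₂ r) → level (proj₂ e′) ≡ level (proj₂ r) →
    code r e ≡ code r e′ → proj₁ e ≡ proj₁ e′
  code-injective (_ , ρ) (_ , π) (_ , σ) π~ρ σ~ρ =
    cross-injective ρ π σ ∘ ∣i+n∣-injective (∣cross∣≤∣D∣ ρ π π~ρ) (∣cross∣≤∣D∣ ρ σ σ~ρ)
  distinct : AllPairs (_≢_ on proj₁) roots
  distinct = AllPairsP.map⁻ (subst Unique (sym (map-proj₁-toList ρs)) unique)

completing-square : ∀ a b c x →
  (+ 2 ℤ.* a ℤ.* x ℤ.+ b) ℤ.* (+ 2 ℤ.* a ℤ.* x ℤ.+ b) ≡ disc a b c ℤ.+ + 4 ℤ.* a ℤ.* evalℤ a b c x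
completing-square = expanded
  where
  expanded : ∀ a b c x → (+ 2 ℤ.* a ℤ.* x ℤ.+ b) ℤ.* (+ 2 ℤ.* a ℤ.* x ℤ.+ b)
    ≡ (b ℤ.* b ℤ.- + 4 ℤ.* a ℤ.* c) ℤ.+ + 4 ℤ.* a ℤ.* (a ℤ.* x ℤ.* x ℤ.+ b ℤ.* x ℤ.+ c)
  expanded = solve-∀

squareDivisor⇒root² : ∀ a b c x {k p} → evalℤ (+ a) b c x ≡ + (k ℕ.* (p ℕ.* p)) →
  let Y = + 2 ℤ.* + a ℤ.* x ℤ.+ b in
  + ℤ.∣ Y ∣ ℤ.* + ℤ.∣ Y ∣ ≡ disc (+ a) b c ℤ.+ + (4 ℕ.* a ℕ.* k) ℤ.* (+ p ℤ.* + p)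
squareDivisor⇒root² a b c x {k} {p} f≡kp² = begin
  + ℤ.∣ Y ∣ ℤ.* + ℤ.∣ Y ∣                           ≡⟨ +∣i∣*+∣i∣≡i*i Y ⟩
  Y ℤ.* Y                                           ≡⟨ completing-square (+ a) b c x ⟩
  disc (+ a) b c ℤ.+ + 4 ℤ.* + a ℤ.* evalℤ (+ a) b c x ≡⟨ cong (λ t → disc (+ a) b c ℤ.+ t) 4af≡4akp² ⟩
  disc (+ a) b c ℤ.+ + (4 ℕ.* a ℕ.* k) ℤ.* (+ p ℤ.* + p) ∎
  where
  open ≡-Reasoning
  Y = + 2 ℤ.* + a ℤ.* x ℤ.+ b
  4af≡4akp² : + 4 ℤ.* + a ℤ.* evalℤ (+ a) b c x ≡ + (4 ℕ.* a ℕ.* k) ℤ.* (+ p ℤ.* + p)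
  4af≡4akp² = begin
    + 4 ℤ.* + a ℤ.* evalℤ (+ a) b c x    ≡⟨ cong₂ ℤ._*_ (sym (ℤP.pos-* 4 a)) f≡kp² ⟩
    + (4 ℕ.* a) ℤ.* + (k ℕ.* (p ℕ.* p))  ≡⟨ ℤP.pos-* (4 ℕ.* a) (k ℕ.* (p ℕ.* p)) ⟨
    + (4 ℕ.* a ℕ.* (k ℕ.* (p ℕ.* p)))    ≡⟨ cong +_ (ℕP.*-assoc (4 ℕ.* a) k (p ℕ.* p)) ⟨
    + (4 ℕ.* a ℕ.* k ℕ.* (p ℕ.* p))      ≡⟨ ℤP.pos-* (4 ℕ.* a ℕ.* k) (p ℕ.* p) ⟩
    + (4 ℕ.* a ℕ.* k) ℤ.* + (p ℕ.* p)    ≡⟨ cong (+ (4 ℕ.* a ℕ.* k) ℤ.*_) (ℤP.pos-* p p) ⟩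
    + (4 ℕ.* a ℕ.* k) ℤ.* (+ p ℤ.* + p)  ∎

∣evalℤ∣≤ : ∀ a b c {i n} → 1 ≤ i → i ≤ n →
  ℤ.∣ evalℤ a b c (+ i) ∣ ≤ (ℤ.∣ a ∣ ℕ.+ ℤ.∣ b ∣ ℕ.+ ℤ.∣ c ∣) ℕ.* n ℕ.* n
∣evalℤ∣≤ a b c {i} {n} 1≤i i≤n = begin
  ℤ.∣ a ℤ.* + i ℤ.* + i ℤ.+ b ℤ.* + i ℤ.+ c ∣
    ≤⟨ ℤP.∣i+j∣≤∣i∣+∣j∣ (a ℤ.* + i ℤ.* + i ℤ.+ b ℤ.* + i) c ⟩
  ℤ.∣ a ℤ.* + i ℤ.* + i ℤ.+ b ℤ.* + i ∣ ℕ.+ ℤ.∣ c ∣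
    ≤⟨ ℕP.+-monoˡ-≤ ℤ.∣ c ∣ (ℤP.∣i+j∣≤∣i∣+∣j∣ (a ℤ.* + i ℤ.* + i) (b ℤ.* + i)) ⟩
  ℤ.∣ a ℤ.* + i ℤ.* + i ∣ ℕ.+ ℤ.∣ b ℤ.* + i ∣ ℕ.+ ℤ.∣ c ∣
    ≡⟨ cong₂ (λ s t → s ℕ.+ t ℕ.+ ℤ.∣ c ∣)
         (trans (ℤP.abs-* (a ℤ.* + i) (+ i)) (cong (ℕ._* i) (ℤP.abs-* a (+ i)))) (ℤP.abs-* b (+ i)) ⟩
  ℤ.∣ a ∣ ℕ.* i ℕ.* i ℕ.+ ℤ.∣ b ∣ ℕ.* i ℕ.+ ℤ.∣ c ∣
    ≤⟨ ℕP.+-mono-≤ (ℕP.+-mono-≤ (ℕP.*-mono-≤ (ℕP.*-monoʳ-≤ ℤ.∣ a ∣ i≤n) i≤n) (ℕP.*-monoʳ-≤ ℤ.∣ b ∣ i≤n²))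
                   (ℕP.m≤m*n ℤ.∣ c ∣ (n ℕ.* n) {{n²≢0}}) ⟩
  ℤ.∣ a ∣ ℕ.* n ℕ.* n ℕ.+ ℤ.∣ b ∣ ℕ.* (n ℕ.* n) ℕ.+ ℤ.∣ c ∣ ℕ.* (n ℕ.* n)
    ≡⟨ collect ℤ.∣ a ∣ ℤ.∣ b ∣ ℤ.∣ c ∣ n ⟩
  (ℤ.∣ a ∣ ℕ.+ ℤ.∣ b ∣ ℕ.+ ℤ.∣ c ∣) ℕ.* n ℕ.* n ∎
  where
  open ℕP.≤-Reasoning
  instance
    n≢0 : ℕ.NonZero n
    n≢0 = ℕ.>-nonZero (ℕP.≤-trans 1≤i i≤n)
  n²≢0 : ℕ.NonZero (n ℕ.* n)
  n²≢0 = ℕP.m*n≢0 n n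
  i≤n² : i ≤ n ℕ.* n
  i≤n² = ℕP.≤-trans i≤n (ℕP.m≤m*n n n)
  collect : ∀ s x y n → s ℕ.* n ℕ.* n ℕ.+ x ℕ.* (n ℕ.* n) ℕ.+ y ℕ.* (n ℕ.* n) ≡ (s ℕ.+ x ℕ.+ y) ℕ.* n ℕ.* n
  collect = ℕRing.solve-∀

L≤2p₀⇒L*p₀*p₀≤[d+d]*B : ∀ {L p₀ d B} → L ≤ p₀ ℕ.+ p₀ → p₀ ℕ.* p₀ ≤ d → p₀ ≤ B → L ℕ.* p₀ ℕ.* p₀ ≤ (d ℕ.+ d) ℕ.* B
L≤2p₀⇒L*p₀*p₀≤[d+d]*B {L} {p₀} {d} {B} L≤2p₀ p₀²≤d p₀≤B = begin
  L ℕ.* p₀ ℕ.* p₀                          ≤⟨ ℕP.*-monoˡ-≤ p₀ (ℕP.*-monoˡ-≤ p₀ L≤2p₀) ⟩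
  (p₀ ℕ.+ p₀) ℕ.* p₀ ℕ.* p₀                ≡⟨ regroup p₀ ⟩
  (p₀ ℕ.* p₀ ℕ.+ p₀ ℕ.* p₀) ℕ.* p₀         ≤⟨ ℕP.*-mono-≤ (ℕP.+-mono-≤ p₀²≤d p₀²≤d) p₀≤B ⟩
  (d ℕ.+ d) ℕ.* B                          ∎
  where
  open ℕP.≤-Reasoning
  regroup : ∀ p → (p ℕ.+ p) ℕ.* p ℕ.* p ≡ (p ℕ.* p ℕ.+ p ℕ.* p) ℕ.* p
  regroup = ℕRing.solve-∀

L≤[1+T/p₀²]*W⇒L*p₀*p₀≤W*[T+p₀²] : ∀ {L p₀ T W} .{{_ : ℕ.NonZero (p₀ ℕ.* p₀)}} →
  L ≤ suc (T / (p₀ ℕ.* p₀)) ℕ.* W → L ℕ.* p₀ ℕ.* p₀ ≤ W ℕ.* (T ℕ.+ p₀ ℕ.* p₀)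
L≤[1+T/p₀²]*W⇒L*p₀*p₀≤W*[T+p₀²] {L} {p₀} {T} {W} L≤MW = begin
  L ℕ.* p₀ ℕ.* p₀                                      ≡⟨ ℕP.*-assoc L p₀ p₀ ⟩
  L ℕ.* (p₀ ℕ.* p₀)                                    ≤⟨ ℕP.*-monoˡ-≤ (p₀ ℕ.* p₀) L≤MW ⟩
  suc (T / (p₀ ℕ.* p₀)) ℕ.* W ℕ.* (p₀ ℕ.* p₀)          ≡⟨ regroup (T / (p₀ ℕ.* p₀)) W (p₀ ℕ.* p₀) ⟩
  W ℕ.* (T / (p₀ ℕ.* p₀) ℕ.* (p₀ ℕ.* p₀) ℕ.+ p₀ ℕ.* p₀) ≤⟨ ℕP.*-monoʳ-≤ W (ℕP.+-monoˡ-≤ (p₀ ℕ.* p₀) (m/n*n≤m T (p₀ ℕ.* p₀))) ⟩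
  W ℕ.* (T ℕ.+ p₀ ℕ.* p₀)                              ∎
  where
  open ℕP.≤-Reasoning
  regroup : ∀ m w q → suc m ℕ.* w ℕ.* q ≡ w ℕ.* (m ℕ.* q ℕ.+ q)
  regroup = ℕRing.solve-∀

module SquareDivisors (a : ℕ) .{{_ : ℕ.NonZero a}} (b c : ℤ)
  (f>0 : ∀ {i} → 1 ≤ i → ℤ.0ℤ ℤ.< evalℤ (+ a) b c (+ i)) where

  D : ℤ
  D = disc (+ a) b c

  W : ℕ
  W = suc (ℤ.∣ D ∣ ℕ.+ ℤ.∣ D ∣)

  C : ℕ
  C = a ℕ.+ ℤ.∣ b ∣ ℕ.+ ℤ.∣ c ∣

  module _ (n : ℕ) where

    B : ℕ
    B = C ℕ.* n ℕ.* n

    SquareDivisor : ℕ → Set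
    SquareDivisor p = Prime p × ¬ ((+ p) ℤᵈ.∣ D)
      × ∃ λ (i : ℕ) → 1 ≤ i × i ≤ n × (+ (p ℕ.* p)) ℤᵈ.∣ evalℤ (+ a) b c (+ i)

    p²≤B : ∀ {p} → SquareDivisor p → p ℕ.* p ≤ B
    p²≤B (_ , _ , i , 1≤i , i≤n , p²∣f) =
      ℕP.≤-trans (ℕᵈ.∣⇒≤ {{ℤ.>-nonZero (f>0 1≤i)}} p²∣f) (∣evalℤ∣≤ (+ a) b c 1≤i i≤n)

    toWindowRoot : ∀ {p₀ p} .{{_ : ℕ.NonZero (p₀ ℕ.* p₀)}} → ℤ.∣ D ∣ ≤ p₀ ℕ.* p₀ →
      SquareDivisor p → p₀ ≤ p → p < p₀ ℕ.+ p₀ → WindowRoot D p₀ (suc (4 ℕ.* a ℕ.* B / (p₀ ℕ.* p₀))) p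
    toWindowRoot {p₀} {p} ∣D∣≤p₀² (p-prime , p∤D , i , 1≤i , i≤n , p²∣f) p₀≤p p<2p₀ = record
      { isPrime = p-prime ; p∤D = p∤D ; p₀≤p = p₀≤p ; p<2p₀ = p<2p₀
      ; root = ℤ.∣ + 2 ℤ.* + a ℤ.* + i ℤ.+ b ∣ ; level = 4 ℕ.* a ℕ.* k ; root² = root²≡
      ; p≤root = root≥p {D} root²≡ 2≤level (ℕP.≤-trans ∣D∣≤p₀² (ℕP.*-mono-≤ p₀≤p p₀≤p))
      ; level<M = s≤s (m*n≤o⇒m≤o/n level*p₀²≤4aB) }
      where
      k = ℕᵈ.quotient p²∣f
      ∣f∣≡kp² : ℤ.∣ evalℤ (+ a) b c (+ i) ∣ ≡ k ℕ.* (p ℕ.* p)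
      ∣f∣≡kp² = ℕᵈ.m∣n⇒n≡quotient*m p²∣f
      root²≡ : + ℤ.∣ + 2 ℤ.* + a ℤ.* + i ℤ.+ b ∣ ℤ.* + ℤ.∣ + 2 ℤ.* + a ℤ.* + i ℤ.+ b ∣
             ≡ D ℤ.+ + (4 ℕ.* a ℕ.* k) ℤ.* (+ p ℤ.* + p)
      root²≡ = squareDivisor⇒root² a b c (+ i) {k} {p}
        (trans (sym (ℤP.0≤i⇒+∣i∣≡i (ℤP.<⇒≤ (f>0 1≤i)))) (cong +_ ∣f∣≡kp²))
      2≤level : 2 ≤ 4 ℕ.* a ℕ.* k
      2≤level = ℕP.≤-trans (s≤s (s≤s z≤n)) (ℕP.≤-trans (ℕP.m≤m*n 4 a)
        (ℕP.m≤m*n (4 ℕ.* a) k {{ℕᵈ.quotient≢0 p²∣f {{ℤ.>-nonZero (f>0 1≤i)}}}}))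
      level*p₀²≤4aB : 4 ℕ.* a ℕ.* k ℕ.* (p₀ ℕ.* p₀) ≤ 4 ℕ.* a ℕ.* B
      level*p₀²≤4aB = begin
        4 ℕ.* a ℕ.* k ℕ.* (p₀ ℕ.* p₀)            ≤⟨ ℕP.*-monoʳ-≤ (4 ℕ.* a ℕ.* k) (ℕP.*-mono-≤ p₀≤p p₀≤p) ⟩
        4 ℕ.* a ℕ.* k ℕ.* (p ℕ.* p)              ≡⟨ ℕP.*-assoc (4 ℕ.* a) k (p ℕ.* p) ⟩
        4 ℕ.* a ℕ.* (k ℕ.* (p ℕ.* p))            ≡⟨ cong (4 ℕ.* a ℕ.*_) ∣f∣≡kp² ⟨
        4 ℕ.* a ℕ.* ℤ.∣ evalℤ (+ a) b c (+ i) ∣  ≤⟨ ℕP.*-monoʳ-≤ (4 ℕ.* a) (∣evalℤ∣≤ (+ a) b c 1≤i i≤n) ⟩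
        4 ℕ.* a ℕ.* B                            ∎
        where open ℕP.≤-Reasoning

    length*p₀*p₀≤ : ∀ {p₀ ps} → SquareDivisor p₀ → Unique ps → All SquareDivisor ps →
      All (p₀ ≤_) ps → All (_< p₀ ℕ.+ p₀) ps → length ps ℕ.* p₀ ℕ.* p₀ ≤ suc (4 ℕ.* a) ℕ.* W ℕ.* B
    length*p₀*p₀≤ {p₀} {ps} p₀-divisor unique divisors lower upper with ℤ.∣ D ∣ ℕP.≤? p₀ ℕ.* p₀
    ... | yes ∣D∣≤p₀² = begin
      length ps ℕ.* p₀ ℕ.* p₀                  ≤⟨ L≤[1+T/p₀²]*W⇒L*p₀*p₀≤W*[T+p₀²] (windowRoots-length≤ unique roots) ⟩
      W ℕ.* (4 ℕ.* a ℕ.* B ℕ.+ p₀ ℕ.* p₀)       ≤⟨ ℕP.*-monoʳ-≤ W (ℕP.+-monoʳ-≤ (4 ℕ.* a ℕ.* B) (p²≤B p₀-divisor)) ⟩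
      W ℕ.* (4 ℕ.* a ℕ.* B ℕ.+ B)               ≡⟨ regroup a W B ⟩
      suc (4 ℕ.* a) ℕ.* W ℕ.* B                ∎
      where
      open ℕP.≤-Reasoning
      instance
        p₀²≢0 : ℕ.NonZero (p₀ ℕ.* p₀)
        p₀²≢0 = ℕP.m*n≢0 p₀ p₀ {{prime⇒nonZero (proj₁ p₀-divisor)}} {{prime⇒nonZero (proj₁ p₀-divisor)}}
      roots : All (WindowRoot D p₀ (suc (4 ℕ.* a ℕ.* B / (p₀ ℕ.* p₀)))) ps
      roots = All.zipWith (λ (divisor , p₀≤p , p<2p₀) → toWindowRoot ∣D∣≤p₀² divisor p₀≤p p<2p₀)
                (divisors , All.zip (lower , upper))
      regroup : ∀ a w b → w ℕ.* (4 ℕ.* a ℕ.* b ℕ.+ b) ≡ suc (4 ℕ.* a) ℕ.* w ℕ.* b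
      regroup = ℕRing.solve-∀
    ... | no ∣D∣≰p₀² = begin
      length ps ℕ.* p₀ ℕ.* p₀                  ≤⟨ L≤2p₀⇒L*p₀*p₀≤[d+d]*B (unique-bounded⇒length≤ (p₀ ℕ.+ p₀) upper unique)
                                                     (ℕP.<⇒≤ (ℕP.≰⇒> ∣D∣≰p₀²)) (ℕP.≤-trans (ℕP.m≤m*n p₀ p₀) (p²≤B p₀-divisor)) ⟩
      (ℤ.∣ D ∣ ℕ.+ ℤ.∣ D ∣) ℕ.* B              ≤⟨ ℕP.*-monoˡ-≤ B (ℕP.n≤1+n (ℤ.∣ D ∣ ℕ.+ ℤ.∣ D ∣)) ⟩
      W ℕ.* B                                  ≤⟨ ℕP.*-monoˡ-≤ B (ℕP.m≤n*m W (suc (4 ℕ.* a))) ⟩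
      suc (4 ℕ.* a) ℕ.* W ℕ.* B                ∎
      where
      open ℕP.≤-Reasoning
      instance
        p₀≢0 : ℕ.NonZero p₀
        p₀≢0 = prime⇒nonZero (proj₁ p₀-divisor)

ℤ→ℚ≡mkℚ : ∀ z → ℤ→ℚ z ≡ mkℚ z 0 (Coprimality.sym (Coprimality.1-coprimeTo ℤ.∣ z ∣))
ℤ→ℚ≡mkℚ z = ℚP.↥p/↧p≡p (mkℚ z 0 _)

ℤ→ℚ-homo-* : ∀ x y → ℤ→ℚ (x ℤ.* y) ≡ ℤ→ℚ x ℚ.* ℤ→ℚ y
ℤ→ℚ-homo-* x y rewrite ℤ→ℚ≡mkℚ x | ℤ→ℚ≡mkℚ y = refl

ℤ→ℚ-homo-+ : ∀ x y → ℤ→ℚ (x ℤ.+ y) ≡ ℤ→ℚ x ℚ.+ ℤ→ℚ y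
ℤ→ℚ-homo-+ x y rewrite ℤ→ℚ≡mkℚ x | ℤ→ℚ≡mkℚ y | ℤP.*-identityʳ x | ℤP.*-identityʳ y = refl

ℤ→ℚ-evalℤ : ∀ a b c x → ℤ→ℚ (evalℤ a b c x) ≡ evalℚ a b c (ℤ→ℚ x)
ℤ→ℚ-evalℤ a b c x = begin
  ℤ→ℚ (a ℤ.* x ℤ.* x ℤ.+ b ℤ.* x ℤ.+ c)
    ≡⟨ ℤ→ℚ-homo-+ (a ℤ.* x ℤ.* x ℤ.+ b ℤ.* x) c ⟩
  ℤ→ℚ (a ℤ.* x ℤ.* x ℤ.+ b ℤ.* x) ℚ.+ ℤ→ℚ c
    ≡⟨ cong (ℚ._+ ℤ→ℚ c) (ℤ→ℚ-homo-+ (a ℤ.* x ℤ.* x) (b ℤ.* x)) ⟩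
  ℤ→ℚ (a ℤ.* x ℤ.* x) ℚ.+ ℤ→ℚ (b ℤ.* x) ℚ.+ ℤ→ℚ c
    ≡⟨ cong₂ (λ s t → s ℚ.+ t ℚ.+ ℤ→ℚ c)
         (trans (ℤ→ℚ-homo-* (a ℤ.* x) x) (cong (ℚ._* ℤ→ℚ x) (ℤ→ℚ-homo-* a x))) (ℤ→ℚ-homo-* b x) ⟩
  evalℚ a b c (ℤ→ℚ x) ∎
  where open ≡-Reasoning

ℤ→ℚ-cancel-< : ∀ {x y} → ℤ→ℚ x ℚ.< ℤ→ℚ y → x ℤ.< y
ℤ→ℚ-cancel-< {x} {y} x<y rewrite ℤ→ℚ≡mkℚ x | ℤ→ℚ≡mkℚ y
  with ℚP.drop-*<* x<y
... | x*1<y*1 rewrite ℤP.*-identityʳ x | ℤP.*-identityʳ y = x*1<y*1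

ℕ→ℚ-mono-≤ : ∀ {m n} → m ≤ n → ℕ→ℚ m ℚ.≤ ℕ→ℚ n
ℕ→ℚ-mono-≤ {m} {n} m≤n rewrite ℤ→ℚ≡mkℚ (+ m) | ℤ→ℚ≡mkℚ (+ n) =
  *≤* (subst₂ ℤ._≤_ (sym (ℤP.*-identityʳ (+ m))) (sym (ℤP.*-identityʳ (+ n))) (ℤ.+≤+ m≤n))

ℕ→ℚ-cancel-< : ∀ {m n} → ℕ→ℚ m ℚ.< ℕ→ℚ n → m < n
ℕ→ℚ-cancel-< = ℤP.drop‿+<+ ∘′ ℤ→ℚ-cancel-<

ℕ→ℚ-homo-* : ∀ m n → ℕ→ℚ (m ℕ.* n) ≡ ℕ→ℚ m ℚ.* ℕ→ℚ n
ℕ→ℚ-homo-* m n = trans (cong ℤ→ℚ (ℤP.pos-* m n)) (ℤ→ℚ-homo-* (+ m) (+ n))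

ℕ→ℚ-nonNeg : ∀ n → ℚ.NonNegative (ℕ→ℚ n)
ℕ→ℚ-nonNeg n rewrite ℤ→ℚ≡mkℚ (+ n) = _

ℕ→ℚ-homo-*-* : ∀ l m n → ℕ→ℚ (l ℕ.* m ℕ.* n) ≡ ℕ→ℚ l ℚ.* ℕ→ℚ m ℚ.* ℕ→ℚ n
ℕ→ℚ-homo-*-* l m n = trans (ℕ→ℚ-homo-* (l ℕ.* m) n) (cong (ℚ._* ℕ→ℚ n) (ℕ→ℚ-homo-* l m))

*-*-monoʳ-≤-nonNeg : ∀ r {p q} .{{_ : ℚ.NonNegative r}} .{{_ : ℚ.NonNegative p}} →
  p ℚ.≤ q → r ℚ.* p ℚ.* p ℚ.≤ r ℚ.* q ℚ.* q
*-*-monoʳ-≤-nonNeg r {p} {q} p≤q = ℚP.≤-trans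
  (ℚP.*-monoˡ-≤-nonNeg (r ℚ.* p) {{ℚP.nonNeg*nonNeg⇒nonNeg r p}} p≤q)
  (ℚP.*-monoʳ-≤-nonNeg q {{ℚ.nonNegative (ℚP.≤-trans (ℚP.nonNegative⁻¹ p) p≤q)}} (ℚP.*-monoˡ-≤-nonNeg r p≤q))

L*p*p≤K*n*n⇒L*Q*Q≤K*n*n : ∀ {L p K n} {Q} → ℚ.0ℚ ℚ.≤ Q → Q ℚ.≤ ℕ→ℚ p → L ℕ.* p ℕ.* p ≤ K ℕ.* n ℕ.* n →
  ℕ→ℚ L ℚ.* Q ℚ.* Q ℚ.≤ ℕ→ℚ K ℚ.* ℕ→ℚ n ℚ.* ℕ→ℚ n
L*p*p≤K*n*n⇒L*Q*Q≤K*n*n {L} {p} {K} {n} {Q} 0≤Q Q≤p Lpp≤Knn = begin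
  ℕ→ℚ L ℚ.* Q ℚ.* Q                 ≤⟨ *-*-monoʳ-≤-nonNeg (ℕ→ℚ L) {{ℕ→ℚ-nonNeg L}} {{ℚ.nonNegative 0≤Q}} Q≤p ⟩
  ℕ→ℚ L ℚ.* ℕ→ℚ p ℚ.* ℕ→ℚ p         ≡⟨ ℕ→ℚ-homo-*-* L p p ⟨
  ℕ→ℚ (L ℕ.* p ℕ.* p)               ≤⟨ ℕ→ℚ-mono-≤ Lpp≤Knn ⟩
  ℕ→ℚ (K ℕ.* n ℕ.* n)               ≡⟨ ℕ→ℚ-homo-*-* K n n ⟩
  ℕ→ℚ K ℚ.* ℕ→ℚ n ℚ.* ℕ→ℚ n         ∎
  where open ℚP.≤-Reasoning

<2Q⇒<p₀+p₀ : ∀ {p p₀ Q} → Q ℚ.≤ ℕ→ℚ p₀ → ℕ→ℚ p ℚ.< ℕ→ℚ 2 ℚ.* Q → p < p₀ ℕ.+ p₀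
<2Q⇒<p₀+p₀ {p} {p₀} {Q} Q≤p₀ p<2Q = subst (p <_) (cong (p₀ ℕ.+_) (ℕP.+-identityʳ p₀)) (ℕ→ℚ-cancel-< (begin-strict
  ℕ→ℚ p               <⟨ p<2Q ⟩
  ℕ→ℚ 2 ℚ.* Q         ≤⟨ ℚP.*-monoˡ-≤-nonNeg (ℕ→ℚ 2) {{ℕ→ℚ-nonNeg 2}} Q≤p₀ ⟩
  ℕ→ℚ 2 ℚ.* ℕ→ℚ p₀    ≡⟨ ℕ→ℚ-homo-* 2 p₀ ⟨
  ℕ→ℚ (2 ℕ.* p₀)      ∎))
  where open ℚP.≤-Reasoning

module _ (a : ℕ) .{{_ : ℕ.NonZero a}} (b c : ℤ)
  (f>0 : ∀ {i} → 1 ≤ i → ℤ.0ℤ ℤ.< evalℤ (+ a) b c (+ i)) where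

  open SquareDivisors a b c f>0

  WindowedSquareDivisor : ℕ → ℚ → ℕ → Set
  WindowedSquareDivisor n Q p = Prime p × ¬ ((+ p) ℤᵈ.∣ D) × Q ℚ.≤ ℕ→ℚ p × ℕ→ℚ p ℚ.< ℕ→ℚ 2 ℚ.* Q
    × ∃ λ (i : ℕ) → 1 ≤ i × i ≤ n × (+ (p ℕ.* p)) ℤᵈ.∣ evalℤ (+ a) b c (+ i)

  windowedSquareDivisors-bound : ∀ n Q → ℚ.1ℚ ℚ.≤ Q → ∀ ps → Unique ps → All (WindowedSquareDivisor n Q) ps →
    ℕ→ℚ (length ps) ℚ.* Q ℚ.* Q ℚ.≤ ℕ→ℚ (suc (4 ℕ.* a) ℕ.* W ℕ.* C) ℚ.* ℕ→ℚ n ℚ.* ℕ→ℚ n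
  windowedSquareDivisors-bound n Q _ [] _ [] = begin
    ℕ→ℚ 0 ℚ.* Q ℚ.* Q             ≡⟨ trans (cong (ℚ._* Q) (ℚP.*-zeroˡ Q)) (ℚP.*-zeroˡ Q) ⟩
    ℕ→ℚ 0                         ≤⟨ ℕ→ℚ-mono-≤ {0} {K ℕ.* n ℕ.* n} z≤n ⟩
    ℕ→ℚ (K ℕ.* n ℕ.* n)           ≡⟨ ℕ→ℚ-homo-*-* K n n ⟩
    ℕ→ℚ K ℚ.* ℕ→ℚ n ℚ.* ℕ→ℚ n     ∎
    where
    open ℚP.≤-Reasoning
    K = suc (4 ℕ.* a) ℕ.* W ℕ.* C
  windowedSquareDivisors-bound n Q 1≤Q ps@(x ∷ xs) unique windowed =
    L*p*p≤K*n*n⇒L*Q*Q≤K*n*n {length ps} {p₀} {suc (4 ℕ.* a) ℕ.* W ℕ.* C} {n} (ℚP.≤-trans (ℚP.nonNegative⁻¹ ℚ.1ℚ) 1≤Q) Q≤p₀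
      (subst (length ps ℕ.* p₀ ℕ.* p₀ ≤_) (regroup (suc (4 ℕ.* a) ℕ.* W) C n)
        (length*p₀*p₀≤ n p₀-divisor unique (All.map forgetWindow windowed) lower upper))
    where
    p₀ = min x xs
    forgetWindow : ∀ {p} → WindowedSquareDivisor n Q p → SquareDivisor n p
    forgetWindow (p-prime , p∤D , _ , _ , divisor) = p-prime , p∤D , divisor
    p₀-windowed : WindowedSquareDivisor n Q p₀
    p₀-windowed = argmin-all id (All.head windowed) (All.tail windowed)
    p₀-divisor = forgetWindow p₀-windowed
    Q≤p₀ : Q ℚ.≤ ℕ→ℚ p₀
    Q≤p₀ = proj₁ (proj₂ (proj₂ p₀-windowed))
    lower : All (p₀ ≤_) ps
    lower = min≤⊤ x xs ∷ min≤xs x xs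
    upper : All (_< p₀ ℕ.+ p₀) ps
    upper = All.map (λ (_ , _ , _ , p<2Q , _) → <2Q⇒<p₀+p₀ {p₀ = p₀} Q≤p₀ p<2Q) windowed
    regroup : ∀ k c n → k ℕ.* (c ℕ.* n ℕ.* n) ≡ k ℕ.* c ℕ.* n ℕ.* n
    regroup = ℕRing.solve-∀

mainTheorem8 : (a b c : ℤ) → IrreducibleQuadℤ a b c → ℤ.0ℤ ℤ.< a
    → (∀ (x : ℚ) → ℚ.1ℚ ℚ.≤ x → ℚ.0ℚ ℚ.< evalℚ a b c x)
    → (∀ (x y : ℚ) → ℚ.1ℚ ℚ.≤ x → x ℚ.< y → evalℚ a b c x ℚ.< evalℚ a b c y)
    → ∃ λ (K : ℕ) → ∀ (n : ℕ) (Q : ℚ) → 1 ℕ.≤ n → ℚ.1ℚ ℚ.≤ Q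
      → ∀ (ps : List ℕ) → Unique ps
      → All (λ p → Prime p
                 × ¬ ((+ p) ℤᵈ.∣ disc a b c)
                 × Q ℚ.≤ ℕ→ℚ p × ℕ→ℚ p ℚ.< ℕ→ℚ 2 ℚ.* Q
                 × ∃ λ (i : ℕ) → 1 ℕ.≤ i × i ℕ.≤ n
                     × (+ (p ℕ.* p)) ℤᵈ.∣ evalℤ a b c (+ i)) ps
      → ℕ→ℚ (length ps) ℚ.* Q ℚ.* Q ℚ.≤ ℕ→ℚ K ℚ.* ℕ→ℚ n ℚ.* ℕ→ℚ n
mainTheorem8 (+ zero) _ _ _ (ℤ.+<+ ()) _ _
mainTheorem8 -[1+ _ ] _ _ _ () _ _
mainTheorem8 (+ a@(suc _)) b c _ _ f>0 _ =
  suc (4 ℕ.* a) ℕ.* W ℕ.* C , λ n Q _ → windowedSquareDivisors-bound a b c fᵢ>0 n Q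
  where
  fᵢ>0 : ∀ {i} → 1 ≤ i → ℤ.0ℤ ℤ.< evalℤ (+ a) b c (+ i)
  fᵢ>0 {i} 1≤i = ℤ→ℚ-cancel-< (subst (ℚ.0ℚ ℚ.<_) (sym (ℤ→ℚ-evalℤ (+ a) b c (+ i))) (f>0 (ℕ→ℚ i) (ℕ→ℚ-mono-≤ 1≤i)))
  open SquareDivisors a b c fᵢ>0 using (W; C)
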